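{- Let $H$ be a $2$-intersecting $r$-uniform hypergraph and let $k\ge 0$ be an integer. If $\frac{k}{2}r+1<|E(H)|$, then $H$ has a vertex of degree at least $k+2$.
   Context: A hypergraph is $r$-uniform if every edge has exactly $r$ vertices, and $2$-intersecting if any two distinct edges share at least two vertices. The degree of a vertex is the number of edges containing it. Hypergraphs are finite and simple. -}

module Defs where

open import Data.Nat using (ℕ; _≤_)
open import Data.Fin using (Fin)
open import Data.Fin.Subset using (Subset; ∣_∣; _∩_; _∈_)
open import Data.Fin.Subset.Properties using (_∈?_)
open import Data.List using (List; filter; length)
open import Data.List.Relation.Unary.Unique.Propositional using (Unique)
import Data.List.Membership.Propositional as L
open import Relation.Binary.PropositionalEquality using (_≡_; _≢_)
open import Relation.Unary using (Pred)

record Hypergraph (n : ℕ) : Set where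
  field
    edges  : List (Subset n)
    simple : Unique edges
open Hypergraph public

numEdges : ∀ {n} → Hypergraph n → ℕ
numEdges H = length (edges H)

Uniform : ∀ {n} → ℕ → Hypergraph n → Set
Uniform r H = ∀ {e} → e L.∈ edges H → ∣ e ∣ ≡ r

TwoIntersecting : ∀ {n} → Hypergraph n → Set
TwoIntersecting H = ∀ {e f} → e L.∈ edges H → f L.∈ edges H → e ≢ f → 2 ≤ ∣ e ∩ f ∣

degree : ∀ {n} → Hypergraph n → Fin n → ℕ
degree H v = length (filter (λ e → v ∈? e) (edges H))

module Submission where

open import Defs
open import Data.Nat using (ℕ; _+_; _*_; _<_; _≤_)
open import Data.Fin using (Fin)
open import Data.Product using (∃)

open import Data.Nat using (suc; z≤n; _≤?_)
open import Data.Nat.ListAction using (sum)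
open import Data.Nat.Properties
open import Algebra.Properties.CommutativeSemigroup +-commutativeSemigroup using (x∙yz≈y∙xz)
open import Data.Nat.Tactic.RingSolver using (solve-∀)
open import Data.Fin using (zero; suc)
open import Data.Fin.Properties using (any?)
open import Data.Bool using (true; false)
open import Data.Vec using ([]; _∷_; tail)
open import Data.Fin.Subset using (Subset; inside; outside; ∣_∣; _∩_)
open import Data.Fin.Subset.Properties using (_∈?_; ∩-idem)
open import Data.List using (List; []; _∷_; filter; length; map)
open import Data.List.Membership.Propositional using (_∈_)
open import Data.List.Relation.Unary.Any using (here; there)
open import Data.List.Relation.Unary.All using (lookup)
open import Data.List.Relation.Unary.AllPairs using (_∷_)
open import Data.List.Relation.Unary.Unique.Propositional using (Unique)
open import Data.Product using (_,_)
open import Function using (_∘_)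
open import Relation.Nullary using (does; yes; no; contradiction)
open import Relation.Binary.PropositionalEquality
  using (_≡_; _≢_; refl; cong; trans; sym; subst; ≢-sym)

-- Fix an edge e and count Σ_f |e ∩ f| over all edges f in two ways.  Grouping by
-- the vertices of e gives Σ_{v ∈ e} deg v ≤ r (k + 1) when every degree is at most
-- k + 1.  Grouping by edges, f = e contributes r and each of the other |E| - 1
-- edges at least 2.  Hence r + 2 (|E| - 1) ≤ r (k + 1), that is 2 |E| ≤ k r + 2.

private
  variable
    n : ℕ

-- degree H v is degreeIn v (edges H) definitionally.
degreeIn : Fin n → List (Subset n) → ℕ
degreeIn v fs = length (filter (v ∈?_) fs)

intersectionSum : Subset n → List (Subset n) → ℕ
intersectionSum e fs = sum (map (λ f → ∣ e ∩ f ∣) fs)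

degreeIn-map-tail : ∀ (v : Fin n) fs → degreeIn v (map tail fs) ≡ degreeIn (suc v) fs
degreeIn-map-tail v [] = refl
degreeIn-map-tail v ((c ∷ f) ∷ fs) with does (v ∈? f)
... | true  = cong suc (degreeIn-map-tail v fs)
... | false = degreeIn-map-tail v fs

tail-degree≤ : ∀ (fs : List (Subset (suc n))) {d} → (∀ v → degreeIn v fs ≤ d) →
               ∀ v → degreeIn v (map tail fs) ≤ d
tail-degree≤ fs degree≤ v = ≤-trans (≤-reflexive (degreeIn-map-tail v fs)) (degree≤ (suc v))

intersectionSum-outside : ∀ (e : Subset n) fs →
  intersectionSum (outside ∷ e) fs ≡ intersectionSum e (map tail fs)
intersectionSum-outside e [] = refl
intersectionSum-outside e ((c ∷ f) ∷ fs) = cong (∣ e ∩ f ∣ +_) (intersectionSum-outside e fs)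

move-degree-forward : ∀ (e f : Subset n) fs →
  ∣ e ∩ f ∣ + intersectionSum (inside ∷ e) fs ≡
  degreeIn zero fs + (∣ e ∩ f ∣ + intersectionSum e (map tail fs))

intersectionSum-inside : ∀ (e : Subset n) fs →
  intersectionSum (inside ∷ e) fs ≡ degreeIn zero fs + intersectionSum e (map tail fs)
intersectionSum-inside e [] = refl
intersectionSum-inside e ((inside  ∷ f) ∷ fs) = cong suc (move-degree-forward e f fs)
intersectionSum-inside e ((outside ∷ f) ∷ fs) = move-degree-forward e f fs

move-degree-forward e f fs = trans
  (cong (∣ e ∩ f ∣ +_) (intersectionSum-inside e fs))
  (x∙yz≈y∙xz ∣ e ∩ f ∣ (degreeIn zero fs) (intersectionSum e (map tail fs)))

intersectionSum≤ : ∀ (e : Subset n) fs {d} → (∀ v → degreeIn v fs ≤ d) →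
                   intersectionSum e fs ≤ ∣ e ∣ * d
intersectionSum≤ [] [] _ = z≤n
intersectionSum≤ [] ([] ∷ fs) {d} _ = intersectionSum≤ [] fs {d} λ ()
intersectionSum≤ (outside ∷ e) fs {d} degree≤ = begin
  intersectionSum (outside ∷ e) fs ≡⟨ intersectionSum-outside e fs ⟩
  intersectionSum e (map tail fs)  ≤⟨ intersectionSum≤ e (map tail fs) (tail-degree≤ fs degree≤) ⟩
  ∣ e ∣ * d                        ∎
  where open ≤-Reasoning
intersectionSum≤ (inside ∷ e) fs {d} degree≤ = begin
  intersectionSum (inside ∷ e) fs                    ≡⟨ intersectionSum-inside e fs ⟩
  degreeIn zero fs + intersectionSum e (map tail fs) ≤⟨ +-mono-≤ (degree≤ zero)
    (intersectionSum≤ e (map tail fs) (tail-degree≤ fs degree≤)) ⟩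
  d + ∣ e ∣ * d                                      ∎
  where open ≤-Reasoning

twice-length≤intersectionSum : ∀ (e : Subset n) fs → (∀ {f} → f ∈ fs → 2 ≤ ∣ e ∩ f ∣) →
                               2 * length fs ≤ intersectionSum e fs
twice-length≤intersectionSum e [] _ = z≤n
twice-length≤intersectionSum e (f ∷ fs) meets = begin
  2 * suc (length fs)              ≡⟨ *-suc 2 (length fs) ⟩
  2 + 2 * length fs                ≤⟨ +-mono-≤ (meets (here refl))
    (twice-length≤intersectionSum e fs (meets ∘ there)) ⟩
  ∣ e ∩ f ∣ + intersectionSum e fs ∎
  where open ≤-Reasoning

pull-two : ∀ a m → a + 2 * suc m ≡ 2 + (a + 2 * m)
pull-two = solve-∀

member⇒intersectionSum≥ : ∀ {e : Subset n} {fs} → Unique fs → e ∈ fs →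
                          (∀ {f} → f ∈ fs → e ≢ f → 2 ≤ ∣ e ∩ f ∣) →
                          ∣ e ∣ + 2 * length fs ≤ 2 + intersectionSum e fs
member⇒intersectionSum≥ {e = e} {f ∷ fs} (f≢fs ∷ _) (here refl) meets = begin
  ∣ e ∣ + 2 * suc (length fs)            ≡⟨ pull-two ∣ e ∣ (length fs) ⟩
  2 + (∣ e ∣ + 2 * length fs)            ≤⟨ +-monoʳ-≤ 2 (+-mono-≤ (≤-reflexive (cong ∣_∣ (sym (∩-idem e))))
    (twice-length≤intersectionSum e fs (λ g∈fs → meets (there g∈fs) (lookup f≢fs g∈fs)))) ⟩
  2 + (∣ e ∩ e ∣ + intersectionSum e fs) ∎
  where open ≤-Reasoning
member⇒intersectionSum≥ {e = e} {f ∷ fs} (f≢fs ∷ unique) (there e∈fs) meets = begin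
  ∣ e ∣ + 2 * suc (length fs)            ≡⟨ pull-two ∣ e ∣ (length fs) ⟩
  2 + (∣ e ∣ + 2 * length fs)            ≤⟨ +-mono-≤ (meets (here refl) (≢-sym (lookup f≢fs e∈fs)))
    (member⇒intersectionSum≥ unique e∈fs (meets ∘ there)) ⟩
  ∣ e ∩ f ∣ + (2 + intersectionSum e fs) ≡⟨ x∙yz≈y∙xz ∣ e ∩ f ∣ 2 (intersectionSum e fs) ⟩
  2 + (∣ e ∩ f ∣ + intersectionSum e fs) ∎
  where open ≤-Reasoning

twice-length≤k*r+2 : ∀ {r k} (fs : List (Subset n)) → Unique fs →
                     (∀ {e} → e ∈ fs → ∣ e ∣ ≡ r) →
                     (∀ {e f} → e ∈ fs → f ∈ fs → e ≢ f → 2 ≤ ∣ e ∩ f ∣) →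
                     (∀ v → degreeIn v fs ≤ suc k) →
                     2 * length fs ≤ k * r + 2
twice-length≤k*r+2 [] _ _ _ _ = z≤n
twice-length≤k*r+2 {r = r} {k} fs@(e ∷ _) unique uniform twoIntersecting degree≤ =
  +-cancelˡ-≤ r _ _ (begin
    r + 2 * length fs        ≡⟨ cong (_+ 2 * length fs) (sym (uniform (here refl))) ⟩
    ∣ e ∣ + 2 * length fs    ≤⟨ member⇒intersectionSum≥ unique (here refl) (twoIntersecting (here refl)) ⟩
    2 + intersectionSum e fs ≤⟨ +-monoʳ-≤ 2 (intersectionSum≤ e fs degree≤) ⟩
    2 + ∣ e ∣ * suc k        ≡⟨ cong (λ s → 2 + s * suc k) (uniform (here refl)) ⟩
    2 + r * suc k            ≡⟨ rearrange r k ⟩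
    r + (k * r + 2)          ∎)
  where
  open ≤-Reasoning
  rearrange : ∀ r k → 2 + r * suc k ≡ r + (k * r + 2)
  rearrange = solve-∀

mainTheorem11 : ∀ {n} (r k : ℕ) (H : Hypergraph n) → Uniform r H → TwoIntersecting H →
                  k * r + 2 < 2 * numEdges H → ∃ λ (v : Fin n) → k + 2 ≤ degree H v
mainTheorem11 r k H uniform twoIntersecting many with any? (λ v → k + 2 ≤? degree H v)
... | yes high = high
... | no noHigh =
  contradiction (twice-length≤k*r+2 (edges H) (simple H) uniform twoIntersecting degree≤) (<⇒≱ many)
  where
  degree≤ : ∀ v → degree H v ≤ suc k
  degree≤ v = ≤-pred (subst (degree H v <_) (+-comm k 2) (≰⇒> (λ high → noHigh (v , high))))
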